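{- Let $\mathcal O\subseteq\mathbb C$ be a subring containing $1$. The map $W_{\mathsf F}:\mathrm{FCF}(\mathcal O)\to\mathbf Z/2\mathbf Z\ast\mathcal O$, $[x_1,\dots,x_n]\mapsto x_1jx_2j\cdots x_nj$, is constant on $\sim$-equivalence classes and induces a group isomorphism $\overline{W}_{\mathsf F}:\overline{\mathrm{FCF}}(\mathcal O)\xrightarrow{\ \simeq\ }\mathbf Z/2\mathbf Z\ast\mathcal O$.
   Context: $\mathcal O$ is viewed as an additive group; $\mathbf Z/2\mathbf Z\ast\mathcal O$ is the free product and $j$ is the generator of $\mathbf Z/2\mathbf Z$. $\mathrm{FCF}(\mathcal O)$ is the semigroup of finite sequences (words) $[c_1,\dots,c_n]$, $c_i\in\mathcal O$, under concatenation. $\sim$ is the equivalence relation on $\mathrm{FCF}(\mathcal O)$ generated by $u\,[x,0,y]\,v\sim u\,[x+y]\,v$ for all words $u,v$ (possibly empty) and $x,y\in\mathcal O$. $\overline{\mathrm{FCF}}(\mathcal O)$ is the set of equivalence classes with the operation induced by concatenation (which is a group). -}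

module Defs where

open import Level using (Level; _⊔_)
open import Algebra.Bundles using (CommutativeRing)
open import Data.List using (List; []; _∷_; _++_; concatMap)
open import Data.List.NonEmpty using (List⁺; toList)
open import Relation.Binary.Construct.Closure.Equivalence using (EqClosure)

module _ {c ℓ : Level} (𝒪 : CommutativeRing c ℓ) where
  open CommutativeRing 𝒪 using (Carrier; _≈_; _+_; 0#)

  -- The free product  Z/2Z ∗ 𝒪, given by its standard presentation:
  -- words in the alphabet {j} ⊎ 𝒪, modulo  j j = 1,  (x)(y) = (x + y),
  -- (0) = 1, and equality of letters, closed under context and
  -- equivalence.  Multiplication is concatenation, unit the empty word.

  data Letter : Set c where
    jL : Letter
    oL : Carrier → Letter

  FreeWord : Set c
  FreeWord = List Letter

  data FPBasic : FreeWord → FreeWord → Set (c ⊔ ℓ) where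
    jj   : FPBasic (jL ∷ jL ∷ []) []
    add  : ∀ x y → FPBasic (oL x ∷ oL y ∷ []) (oL (x + y) ∷ [])
    unit : FPBasic (oL 0# ∷ []) []
    letter : ∀ {x y} → x ≈ y → FPBasic (oL x ∷ []) (oL y ∷ [])

  data FPStep : FreeWord → FreeWord → Set (c ⊔ ℓ) where
    inCtx : ∀ u v {a b} → FPBasic a b → FPStep (u ++ a ++ v) (u ++ b ++ v)

  _≈ᶠ_ : FreeWord → FreeWord → Set (c ⊔ ℓ)
  _≈ᶠ_ = EqClosure FPStep

  FCF : Set c
  FCF = List⁺ Carrier

  -- generating moves  u [x,0,y] v ~ u [x+y] v  (plus equality of entries,
  -- needed since 𝒪 carries a setoid equality)
  data FCFStep : List Carrier → List Carrier → Set (c ⊔ ℓ) where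
    collapse : ∀ u v x y →
      FCFStep (u ++ x ∷ 0# ∷ y ∷ v) (u ++ (x + y) ∷ v)
    entry : ∀ u v {x y} → x ≈ y → FCFStep (u ++ x ∷ v) (u ++ y ∷ v)

  _∼_ : FCF → FCF → Set (c ⊔ ℓ)
  u ∼ v = EqClosure FCFStep (toList u) (toList v)

  W : FCF → FreeWord
  W u = concatMap (λ x → oL x ∷ jL ∷ []) (toList u)

{-# OPTIONS --safe #-}
-- The inverse of W is W⁻¹ : x ↦ [x,0], j ↦ [0], extended multiplicatively with
-- [0,0] as the empty product.  This is forced by the relations: [x,0,y] ∼ [x+y]
-- makes [x,0] behave as the letter x, and then [0] squares to [0,0], which is a
-- two-sided unit ([0,0,y] ∼ [y] ∼ [y,0,0]).  Both W and W⁻¹ respect the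
-- defining relations (on the free-product side, j 0 j = j j = 1 does all the
-- work), and both composites reduce to the identity modulo the relations.
module Submission where

open import Defs
open import Level using (Level; _⊔_)
open import Algebra.Bundles using (CommutativeRing)
open import Data.List using (List; []; _∷_; _++_; concatMap)
open import Data.List.NonEmpty using (toList; _⁺++⁺_) renaming (_∷_ to _∷⁺_)
open import Data.List.Properties using (++-assoc; concatMap-++)
open import Data.Product using (_×_; ∃; _,_)
open import Function using (_∘_)
open import Relation.Binary.PropositionalEquality as ≡ using (_≡_; refl; subst₂)
open import Relation.Binary.Construct.Closure.Equivalence
  using (EqClosure; gmap; gfold; isEquivalence; symmetric)
open import Relation.Binary.Construct.Closure.ReflexiveTransitive using (ε; _◅_; _◅◅_)
open import Relation.Binary.Construct.Closure.Symmetric using (fwd)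

module _ {c ℓ : Level} (𝒪 : CommutativeRing c ℓ) where
  open CommutativeRing 𝒪 using (Carrier; _≈_; _+_; 0#; +-identityˡ; +-identityʳ)

  private
    _≋_ : FreeWord 𝒪 → FreeWord 𝒪 → Set (c ⊔ ℓ)
    _≋_ = _≈ᶠ_ 𝒪

    _∼ˡ_ : List Carrier → List Carrier → Set (c ⊔ ℓ)
    _∼ˡ_ = EqClosure (FCFStep 𝒪)

  infix 4 _≋_ _∼ˡ_

  ≈ᶠ-reflexive : ∀ {l r} → l ≡ r → l ≋ r
  ≈ᶠ-reflexive refl = ε

  ≈ᶠ-prefix : ∀ p {l r} → l ≋ r → p ++ l ≋ p ++ r
  ≈ᶠ-prefix p = gmap (p ++_) λ { (inCtx u v {a} {b} q) →
    subst₂ (FPStep 𝒪) (++-assoc p u (a ++ v)) (++-assoc p u (b ++ v)) (inCtx (p ++ u) v q) }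

  FPBasic-front : ∀ {a b} w → FPBasic 𝒪 a b → a ++ w ≋ b ++ w
  FPBasic-front w q = fwd (inCtx [] w q) ◅ ε

  j0j≈ε : ∀ w → jL ∷ oL 0# ∷ jL ∷ w ≋ w
  j0j≈ε w = ≈ᶠ-prefix (jL ∷ []) (FPBasic-front (jL ∷ w) unit) ◅◅ FPBasic-front w jj

  ∼ˡ-prefix : ∀ p {l r} → l ∼ˡ r → p ++ l ∼ˡ p ++ r
  ∼ˡ-prefix p = gmap (p ++_) λ
    { (collapse u v x y) →
        subst₂ (FCFStep 𝒪) (++-assoc p u _) (++-assoc p u _) (collapse (p ++ u) v x y)
    ; (entry u v e) →
        subst₂ (FCFStep 𝒪) (++-assoc p u _) (++-assoc p u _) (entry (p ++ u) v e) }

  collapse-front : ∀ x y v → x ∷ 0# ∷ y ∷ v ∼ˡ x + y ∷ v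
  collapse-front x y v = fwd (collapse [] v x y) ◅ ε

  entry-front : ∀ {x y} v → x ≈ y → x ∷ v ∼ˡ y ∷ v
  entry-front v e = fwd (entry [] v e) ◅ ε

  00-absorbˡ : ∀ y v → 0# ∷ 0# ∷ y ∷ v ∼ˡ y ∷ v
  00-absorbˡ y v = collapse-front 0# y v ◅◅ entry-front v (+-identityˡ y)

  00-absorbʳ : ∀ x v → x ∷ 0# ∷ 0# ∷ v ∼ˡ x ∷ v
  00-absorbʳ x v = collapse-front x 0# v ◅◅ entry-front v (+-identityʳ x)

  Wˡ : List Carrier → FreeWord 𝒪
  Wˡ = concatMap (λ x → oL x ∷ jL ∷ [])

  Wˡ-++ : ∀ u v → Wˡ (u ++ v) ≡ Wˡ u ++ Wˡ v
  Wˡ-++ = concatMap-++ _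

  Wˡ-resp-step : ∀ {l r} → FCFStep 𝒪 l r → Wˡ l ≋ Wˡ r
  Wˡ-resp-step (collapse u v x y) =
    subst₂ _≋_ (≡.sym (Wˡ-++ u _)) (≡.sym (Wˡ-++ u _)) (≈ᶠ-prefix (Wˡ u)
      (≈ᶠ-prefix (oL x ∷ []) (j0j≈ε (oL y ∷ jL ∷ Wˡ v))
       ◅◅ FPBasic-front (jL ∷ Wˡ v) (add x y)))
  Wˡ-resp-step (entry u v e) =
    subst₂ _≋_ (≡.sym (Wˡ-++ u _)) (≡.sym (Wˡ-++ u _)) (≈ᶠ-prefix (Wˡ u)
      (FPBasic-front (jL ∷ Wˡ v) (letter e)))

  W-resp-∼ : ∀ u v → _∼_ 𝒪 u v → W 𝒪 u ≋ W 𝒪 v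
  W-resp-∼ u v = gfold (isEquivalence (FPStep 𝒪)) Wˡ Wˡ-resp-step

  W-⁺++⁺ : ∀ u v → W 𝒪 (u ⁺++⁺ v) ≡ W 𝒪 u ++ W 𝒪 v
  W-⁺++⁺ u v = Wˡ-++ (toList u) (toList v)

  letterImage : Letter 𝒪 → FCF 𝒪
  letterImage jL     = 0# ∷⁺ []
  letterImage (oL x) = x ∷⁺ 0# ∷ []

  W⁻¹ : FreeWord 𝒪 → FCF 𝒪
  W⁻¹ []      = 0# ∷⁺ 0# ∷ []
  W⁻¹ (a ∷ w) = letterImage a ⁺++⁺ W⁻¹ w

  W⁻¹-++ : ∀ u w → toList (W⁻¹ (u ++ w)) ≡ concatMap (toList ∘ letterImage) u ++ toList (W⁻¹ w)
  W⁻¹-++ []      w = refl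
  W⁻¹-++ (a ∷ u) w = ≡.trans (≡.cong (toList (letterImage a) ++_) (W⁻¹-++ u w))
    (≡.sym (++-assoc (toList (letterImage a)) (concatMap (toList ∘ letterImage) u) _))

  W⁻¹-resp-basic : ∀ {a b} w → FPBasic 𝒪 a b → _∼_ 𝒪 (W⁻¹ (a ++ w)) (W⁻¹ (b ++ w))
  -- W⁻¹ w is nonempty (List⁺ has eta), so the leading [0,0] has an entry to absorb into.
  W⁻¹-resp-basic w jj         = 00-absorbˡ _ _
  W⁻¹-resp-basic w (add x y)  = collapse-front x y (0# ∷ toList (W⁻¹ w))
  W⁻¹-resp-basic w unit       = 00-absorbˡ _ _
  W⁻¹-resp-basic w (letter e) = entry-front (0# ∷ toList (W⁻¹ w)) e

  W⁻¹-resp-step : ∀ {l r} → FPStep 𝒪 l r → _∼_ 𝒪 (W⁻¹ l) (W⁻¹ r)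
  W⁻¹-resp-step (inCtx u v {a} {b} q) =
    subst₂ _∼ˡ_ (≡.sym (W⁻¹-++ u (a ++ v))) (≡.sym (W⁻¹-++ u (b ++ v)))
      (∼ˡ-prefix (concatMap (toList ∘ letterImage) u) (W⁻¹-resp-basic v q))

  W⁻¹-resp-≈ᶠ : ∀ {l r} → l ≋ r → _∼_ 𝒪 (W⁻¹ l) (W⁻¹ r)
  W⁻¹-resp-≈ᶠ = gfold (isEquivalence (FCFStep 𝒪)) (toList ∘ W⁻¹) W⁻¹-resp-step

  W⁻¹∘W : ∀ u → _∼_ 𝒪 (W⁻¹ (W 𝒪 u)) u
  W⁻¹∘W (x ∷⁺ xs) = W⁻¹∘W-∷ x xs
    where
    W⁻¹∘W-∷ : ∀ x xs → _∼_ 𝒪 (W⁻¹ (W 𝒪 (x ∷⁺ xs))) (x ∷⁺ xs)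
    W⁻¹∘W-∷ x []       = 00-absorbʳ x (0# ∷ 0# ∷ []) ◅◅ 00-absorbʳ x []
    W⁻¹∘W-∷ x (y ∷ ys) = ∼ˡ-prefix (x ∷ 0# ∷ 0# ∷ []) (W⁻¹∘W-∷ y ys) ◅◅ 00-absorbʳ x (y ∷ ys)

  W∘W⁻¹ : ∀ w → W 𝒪 (W⁻¹ w) ≋ w
  W∘W⁻¹ []          = FPBasic-front (jL ∷ oL 0# ∷ jL ∷ []) unit ◅◅ j0j≈ε []
  W∘W⁻¹ (jL ∷ w)    = FPBasic-front (jL ∷ W 𝒪 (W⁻¹ w)) unit ◅◅ ≈ᶠ-prefix (jL ∷ []) (W∘W⁻¹ w)
  W∘W⁻¹ (oL x ∷ w)  = ≈ᶠ-prefix (oL x ∷ []) (j0j≈ε (W 𝒪 (W⁻¹ w)) ◅◅ W∘W⁻¹ w)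

proposition3p6 : {c ℓ : Level} (𝒪 : CommutativeRing c ℓ) →
    -- W_F is constant on ∼-classes
    (∀ (u v : FCF 𝒪) → _∼_ 𝒪 u v → _≈ᶠ_ 𝒪 (W 𝒪 u) (W 𝒪 v))
    -- the induced map is a homomorphism (concatenation ↦ product)
    × (∀ (u v : FCF 𝒪) → _≈ᶠ_ 𝒪 (W 𝒪 (u ⁺++⁺ v)) (W 𝒪 u ++ W 𝒪 v))
    -- injective on classes
    × (∀ (u v : FCF 𝒪) → _≈ᶠ_ 𝒪 (W 𝒪 u) (W 𝒪 v) → _∼_ 𝒪 u v)
    -- surjective
    × (∀ (w : FreeWord 𝒪) → ∃ λ (u : FCF 𝒪) → _≈ᶠ_ 𝒪 (W 𝒪 u) w)
proposition3p6 𝒪 =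
    W-resp-∼ 𝒪
  , (λ u v → ≈ᶠ-reflexive 𝒪 (W-⁺++⁺ 𝒪 u v))
  , injective
  , λ w → W⁻¹ 𝒪 w , W∘W⁻¹ 𝒪 w
  where
  injective : ∀ u v → _≈ᶠ_ 𝒪 (W 𝒪 u) (W 𝒪 v) → _∼_ 𝒪 u v
  injective u v Wu≈Wv =
    symmetric (FCFStep 𝒪) (W⁻¹∘W 𝒪 u) ◅◅ W⁻¹-resp-≈ᶠ 𝒪 Wu≈Wv ◅◅ W⁻¹∘W 𝒪 v
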